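{- Let $n$ be a positive integer, $n=2q+r$ with $r\in\{0,1\}$. Among all (weakly connected) digraphs on $n$ vertices without loops or multiple arcs that contain no directed $3$-cycle $\overrightarrow{C_3}$ as a subdigraph, the maximum of the First Zagreb index $M_1(G)=\sum_{v}(d_G^+(v))^2$ equals $$\frac{2q}{3}\left(3n^2-6qn+4q^2-1\right),$$ and this maximum is attained exactly by (digraphs isomorphic to) $\overrightarrow{F_{n,2}^{(n+1)/2}}$ if $r=1$, and $\overrightarrow{F_{n,2}^{0}}$ if $r=0$.
   Context: $d_G^+(v)$ is the outdegree of $v$. $\overleftrightarrow{K_m}$ is the complete digraph on $m$ vertices (both arcs between every pair). For disjoint vertex sets, $V_i\mapsto V_j$ means every vertex of $V_i$ has an arc to every vertex of $V_j$ and there is no arc from $V_j$ to $V_i$. For $n=2q+1$, $\overrightarrow{F_{n,2}^{(n+1)/2}}$ is the digraph with vertex partition $V_1,\dots,V_{q+1}$, $|V_i|=2$ for $i\le q$, $|V_{q+1}|=1$, each $V_i$ inducing a complete digraph, $V_i\mapsto V_j$ for $i<j$, and no other arcs. For $n=2q$, $\overrightarrow{F_{n,2}^{0}}$ is the digraph with vertex partition $V_1,\dots,V_q$, $|V_i|=2$, each $V_i$ inducing $\overleftrightarrow{K_2}$, $V_i\mapsto V_j$ for $i<j$, and no other arcs. -}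

module Defs where

open import Data.Nat using (ℕ; zero; suc; _+_; _*_; _∸_; _^_; _≤_; _/_; _≡ᵇ_; _≤ᵇ_)
open import Data.Bool using (Bool; true; false; if_then_else_; not; _∧_)
open import Data.Fin using (Fin; toℕ)
open import Data.List using (List; map; allFin)
open import Data.Nat.ListAction using (sum)
open import Data.Product using (_×_; Σ)
open import Data.Sum using (_⊎_)
open import Relation.Binary.PropositionalEquality using (_≡_; _≢_)
open import Relation.Nullary using (¬_)
open import Function.Bundles using (_↔_; Inverse)

-- A digraph on vertex set Fin n, given by its arc relation:
-- G u v ≡ true  iff there is an arc u → v.  (No multiple arcs by construction.)
Digraph : ℕ → Set
Digraph n = Fin n → Fin n → Bool

Arc : ∀ {n} → Digraph n → Fin n → Fin n → Set
Arc G u v = G u v ≡ true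

Loopless : ∀ {n} → Digraph n → Set
Loopless {n} G = (v : Fin n) → G v v ≡ false

data UWalk {n : ℕ} (G : Digraph n) : Fin n → Fin n → Set where
  here : ∀ {u} → UWalk G u u
  step : ∀ {u w v} → (Arc G u w ⊎ Arc G w u) → UWalk G w v → UWalk G u v

WeaklyConnected : ∀ {n} → Digraph n → Set
WeaklyConnected {n} G = (u v : Fin n) → UWalk G u v

HasC3 : ∀ {n} → Digraph n → Set
HasC3 {n} G = Σ (Fin n) λ a → Σ (Fin n) λ b → Σ (Fin n) λ c →
  (a ≢ b) × (b ≢ c) × (a ≢ c) × Arc G a b × Arc G b c × Arc G c a

Admissible : ∀ {n} → Digraph n → Set
Admissible G = Loopless G × WeaklyConnected G × ¬ HasC3 G

outdeg : ∀ {n} → Digraph n → Fin n → ℕ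
outdeg {n} G v = sum (map (λ w → if G v w then 1 else 0) (allFin n))

M1 : ∀ {n} → Digraph n → ℕ
M1 {n} G = sum (map (λ v → outdeg G v ^ 2) (allFin n))

_≅_ : ∀ {n} → Digraph n → Digraph n → Set
_≅_ {n} G H = Σ (Fin n ↔ Fin n) λ σ →
  (u v : Fin n) → G u v ≡ H (Inverse.to σ u) (Inverse.to σ v)

-- F n : vertex i (0-based) lies in block ⌊i/2⌋ (blocks V_1,…, of size 2, the last
-- of size 1 when n is odd).  Arc i → j (i ≠ j) iff block(i) ≤ block(j):
-- each block is a complete digraph and V_i ↦ V_j for i < j.
-- For n = 2q+1 this is F_{n,2}^{(n+1)/2}; for n = 2q it is F_{n,2}^0.
F : (n : ℕ) → Digraph n
F n i j = not (toℕ i ≡ᵇ toℕ j) ∧ (toℕ i / 2 ≤ᵇ toℕ j / 2)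

-- 3 × (2q/3)(3n² − 6qn + 4q² − 1) = 2q(3n² + 4q² − 6qn − 1)
-- (the subtracted part never exceeds the rest when n = 2q + r ≥ 1, r ≤ 1)
threeBound : ℕ → ℕ → ℕ
threeBound n q = 2 * q * ((3 * n * n + 4 * q * q) ∸ (6 * q * n + 1))

{-# OPTIONS --safe #-}
module Submission where

-- Everything is proved for the subdigraph G[S] induced by a vertex set S, by induction on |S|,
-- deleting a vertex v of minimum outdegree δ. Deleting v lowers M1 by δ² plus 2 d(u) + 1 for
-- every in-neighbour u of v. Split S − v into the in-neighbours of v that v also dominates (B),
-- the other in-neighbours (P) and the rest (T). Since there is no directed triangle, minimality
-- of δ gives δ² ≤ |B|² + |T|², no arc leaves B towards an in-neighbour of v, and G[P] has at
-- most |P|²/2 arcs (remove a digon or a vertex at a time); hence the drop is at most k² + k for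
-- k = |S − v|, and 3 M1 ≤ (n − 1) n (n + 1), which is the paper's bound. In the equality case
-- T is empty, |B| ≤ 1 and |B| ≡ k (mod 2); by induction G[S − v] ≅ F_k, and v extends this
-- isomorphism as the last vertex of F_{k+1}.

open import Defs

open import Data.Bool using (Bool; true; false; if_then_else_; not; _∧_)
import Data.Bool.Properties as Bool
open import Data.Empty using (⊥; ⊥-elim)
open import Data.Fin using (Fin; zero; suc; toℕ; fromℕ<; punchIn)
open import Data.Fin.Properties using (_≟_; any?; punchInᵢ≢i; toℕ-injective; toℕ-fromℕ<; toℕ<n)
import Data.List as List
import Data.List.Properties as List
open import Data.List.Extrema.Nat using (argmin; argmin-all; f[argmin]≤f[xs])
open import Data.List.Membership.Propositional.Properties using (∈-filter⁺; ∈-allFin)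
import Data.List.Relation.Unary.All as All
open import Data.List.Relation.Unary.All.Properties using (all-filter)
open import Data.Nat as ℕ
  using (ℕ; zero; suc; _+_; _*_; _∸_; _^_; _/_; _≤_; _<_; _≡ᵇ_; _≤ᵇ_; ⌊_/2⌋; z≤n; s≤s; z<s)
open import Data.Nat.DivMod using (m/n≡1+[m∸n]/n)
open import Data.Nat.Induction using (<-wellFounded)
open import Data.Nat.ListAction using () renaming (sum to listSum)
open import Data.Nat.Properties hiding (_≟_)
open import Algebra.Properties.CommutativeSemigroup +-commutativeSemigroup using (x∙yz≈y∙xz)
open import Algebra.Properties.Semiring.Sum +-*-semiring
  using (sum; sum-cong-≗; sum-remove; ∑-distrib-+; *-distribˡ-sum)
open import Data.Nat.Tactic.RingSolver using (solve-∀)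
open import Data.Product using (∃; _×_; _,_; proj₁; proj₂)
open import Data.Sum using (_⊎_; inj₁; inj₂)
open import Function using (_∘_; _on_)
open import Function.Bundles using (mk⇔; mk↔ₛ′)
import Induction.WellFounded as WF
open import Induction.WellFounded using (WfRec)
open import Level using (0ℓ)
import Relation.Binary.Construct.On as On
open import Relation.Binary.PropositionalEquality hiding ([_])
open import Relation.Nullary using (¬_; ¬?; Dec; does; yes; no)
open import Relation.Nullary.Decidable using (dec-true; dec-false; does-⇔; _×-dec_)

private
  variable
    n : ℕ

+-tight : ∀ {a b c d} → a ≤ c → b ≤ d → a + b ≡ c + d → a ≡ c × b ≡ d
+-tight {a} {b} {c} {d} a≤c b≤d eq = a≡c , +-cancelˡ-≡ c b d (trans (cong (_+ b) (sym a≡c)) eq)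
  where
  a≡c : a ≡ c
  a≡c = ≤-antisym a≤c (+-cancelʳ-≤ d c a (≤-trans (≤-reflexive (sym eq)) (+-monoʳ-≤ a b≤d)))

∸-exact : ∀ {a} b {c} → a ≡ b + c → a ∸ b ≡ c
∸-exact b {c} a≡b+c = trans (cong (_∸ b) a≡b+c) (m+n∸m≡n b c)

parity : ∀ k → ∃ λ j → k ≡ 2 * j ⊎ k ≡ suc (2 * j)
parity zero = 0 , inj₁ refl
parity (suc k) with parity k
... | j , inj₁ k≡2j = j , inj₂ (cong suc k≡2j)
... | j , inj₂ k≡1+2j = suc j , inj₁ (trans (cong suc k≡1+2j) (sym (*-suc 2 j)))

threeM1Max : ℕ → ℕ
threeM1Max zero = 0
threeM1Max (suc k) = threeM1Max k + 3 * (k * k + k)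

threeM1Max-suc : ∀ k → threeM1Max (suc k) ≡ k * suc k * (k + 2)
threeM1Max-suc zero = refl
threeM1Max-suc (suc k) = trans (cong (_+ 3 * (suc k * suc k + suc k)) (threeM1Max-suc k)) (expand k)
  where
  expand : ∀ k → k * suc k * (k + 2) + 3 * (suc k * suc k + suc k) ≡ suc k * suc (suc k) * (suc k + 2)
  expand = solve-∀

sum-tabulate : (f : Fin n → ℕ) → listSum (List.tabulate f) ≡ sum f
sum-tabulate {zero} f = refl
sum-tabulate {suc n} f = cong (f zero +_) (sum-tabulate (f ∘ suc))

sum-map-allFin : (f : Fin n → ℕ) → listSum (List.map f (List.allFin n)) ≡ sum f
sum-map-allFin f = trans (cong listSum (List.map-tabulate (λ i → i) f)) (sum-tabulate f)

sum-mono-≤ : {f g : Fin n → ℕ} → (∀ i → f i ≤ g i) → sum f ≤ sum g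
sum-mono-≤ {zero} f≤g = z≤n
sum-mono-≤ {suc n} f≤g = +-mono-≤ (f≤g zero) (sum-mono-≤ (f≤g ∘ suc))

sum-const : ∀ c → sum {n} (λ _ → c) ≡ n * c
sum-const {zero} c = refl
sum-const {suc n} c = cong (c +_) (sum-const {n} c)

sum-pick : (f : Fin n → ℕ) (v : Fin n) → sum f ≡ f v + sum (λ u → if does (u ≟ v) then 0 else f u)
sum-pick {suc n} f v = begin
  sum f                              ≡⟨ sum-remove f ⟩
  f v + sum (f ∘ punchIn v)          ≡⟨ cong (f v +_) (sum-cong-≗ off-v) ⟩
  f v + sum (g ∘ punchIn v)          ≡⟨ cong (λ x → f v + (x + sum (g ∘ punchIn v))) g-v ⟩
  f v + (g v + sum (g ∘ punchIn v))  ≡⟨ cong (f v +_) (sum-remove g) ⟨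
  f v + sum g                        ∎
  where
  open ≡-Reasoning
  g : Fin (suc n) → ℕ
  g u = if does (u ≟ v) then 0 else f u
  g-v : 0 ≡ g v
  g-v rewrite dec-true (v ≟ v) refl = refl
  off-v : ∀ i → f (punchIn v i) ≡ g (punchIn v i)
  off-v i rewrite dec-false (punchIn v i ≟ v) (punchInᵢ≢i v i) = refl

Subset : ℕ → Set
Subset n = Fin n → Bool

_∈_ : Fin n → Subset n → Set
u ∈ A = A u ≡ true

_∈?_ : (u : Fin n) (A : Subset n) → Dec (u ∈ A)
u ∈? A = A u Bool.≟ true

full : Subset n
full _ = true

-- Opaque, so that unification never unfolds a membership such as u ∈ X ∩ Y into a Boolean
-- conjunction; otherwise the subsets in the membership lemmas below could not be inferred.
opaque
  _∩_ _∖_ : Subset n → Subset n → Subset n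
  (A ∩ B) u = A u ∧ B u
  (A ∖ B) u = A u ∧ not (B u)

  _─_ : Subset n → Fin n → Subset n
  (A ─ v) u = A u ∧ not (does (u ≟ v))

infixl 6 _∩_ _∖_ _─_
infix 4 _∈_ _∈?_

∑∈ : Subset n → (Fin n → ℕ) → ℕ
∑∈ A f = sum (λ u → if A u then f u else 0)

infixl 10 ∑∈
syntax ∑∈ A (λ u → e) = ∑[ u ∈ A ] e

∣_∣ : Subset n → ℕ
∣ A ∣ = ∑[ _ ∈ A ] 1

private
  variable
    X Y : Subset n
    u v : Fin n
    f g : Fin n → ℕ

opaque
  unfolding _∩_ _∖_ _─_

  ∈∩⁻ : u ∈ X ∩ Y → u ∈ X × u ∈ Y
  ∈∩⁻ {u = u} {X = X} u∈ with X u
  ... | true = refl , u∈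

  ∈∩⁺ : u ∈ X → u ∈ Y → u ∈ X ∩ Y
  ∈∩⁺ u∈X u∈Y rewrite u∈X = u∈Y

  ∈∖⁻ : u ∈ X ∖ Y → u ∈ X × Y u ≡ false
  ∈∖⁻ {u = u} {X = X} {Y = Y} u∈ with X u | Y u
  ... | true | false = refl , refl

  ∈∖⁺ : u ∈ X → Y u ≡ false → u ∈ X ∖ Y
  ∈∖⁺ u∈X u∉Y rewrite u∈X | u∉Y = refl

  ∈─⁻ : u ∈ X ─ v → u ∈ X × u ≢ v
  ∈─⁻ {u = u} {X = X} {v = v} u∈ with X u | u ≟ v
  ... | true | no u≢v = refl , u≢v

  ∈─⁺ : u ∈ X → u ≢ v → u ∈ X ─ v
  ∈─⁺ {u = u} {v = v} u∈X u≢v rewrite u∈X | dec-false (u ≟ v) u≢v = refl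

  ∑-split : (X Y : Subset n) (f : Fin n → ℕ) →
            ∑[ u ∈ X ] f u ≡ ∑[ u ∈ X ∩ Y ] f u + ∑[ u ∈ X ∖ Y ] f u
  ∑-split X Y f = trans (sum-cong-≗ pointwise) (∑-distrib-+ (λ u → if (X ∩ Y) u then f u else 0) _)
    where
    pointwise : ∀ u → (if X u then f u else 0) ≡
                      (if (X ∩ Y) u then f u else 0) + (if (X ∖ Y) u then f u else 0)
    pointwise u with X u | Y u
    ... | true | true = sym (+-identityʳ (f u))
    ... | true | false = refl
    ... | false | _ = refl

  ∑-∩ : (X Y : Subset n) (f : Fin n → ℕ) →
        ∑[ u ∈ X ∩ Y ] f u ≡ ∑[ u ∈ X ] (if Y u then f u else 0)
  ∑-∩ X Y f = sum-cong-≗ pointwise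
    where
    pointwise : ∀ u → (if (X ∩ Y) u then f u else 0) ≡ (if X u then (if Y u then f u else 0) else 0)
    pointwise u with X u
    ... | true = refl
    ... | false = refl

  ∑-remove : (X : Subset n) (f : Fin n → ℕ) → v ∈ X →
             ∑[ u ∈ X ] f u ≡ f v + ∑[ u ∈ X ─ v ] f u
  ∑-remove {v = v} X f v∈X = trans (sum-pick _ v) (cong₂ _+_ f-v (sum-cong-≗ pointwise))
    where
    f-v : (if X v then f v else 0) ≡ f v
    f-v rewrite v∈X = refl
    pointwise : ∀ u → (if does (u ≟ v) then 0 else (if X u then f u else 0)) ≡
                      (if (X ─ v) u then f u else 0)
    pointwise u with does (u ≟ v)
    ... | true = sym (cong (λ b → if b then f u else 0) (Bool.∧-zeroʳ (X u)))
    ... | false = cong (λ b → if b then f u else 0) (sym (Bool.∧-identityʳ (X u)))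

∑-cong : (∀ u → u ∈ X → f u ≡ g u) → ∑[ u ∈ X ] f u ≡ ∑[ u ∈ X ] g u
∑-cong {X = X} {f = f} {g = g} f≡g = sum-cong-≗ pointwise
  where
  pointwise : ∀ u → (if X u then f u else 0) ≡ (if X u then g u else 0)
  pointwise u with X u in u∈X
  ... | true = f≡g u u∈X
  ... | false = refl

∑-mono-≤ : (∀ u → u ∈ X → f u ≤ g u) → ∑[ u ∈ X ] f u ≤ ∑[ u ∈ X ] g u
∑-mono-≤ {X = X} {f = f} {g = g} f≤g = sum-mono-≤ pointwise
  where
  pointwise : ∀ u → (if X u then f u else 0) ≤ (if X u then g u else 0)
  pointwise u with X u in u∈X
  ... | true = f≤g u u∈X
  ... | false = z≤n

∑-⊆ : (∀ u → u ∈ X → u ∈ Y) → ∑[ u ∈ X ] f u ≤ ∑[ u ∈ Y ] f u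
∑-⊆ {X = X} {Y = Y} {f = f} X⊆Y = sum-mono-≤ pointwise
  where
  pointwise : ∀ u → (if X u then f u else 0) ≤ (if Y u then f u else 0)
  pointwise u with X u in u∈X
  ... | true rewrite X⊆Y u u∈X = ≤-refl
  ... | false = z≤n

∑-+ : (X : Subset n) (f g : Fin n → ℕ) →
      ∑[ u ∈ X ] (f u + g u) ≡ ∑[ u ∈ X ] f u + ∑[ u ∈ X ] g u
∑-+ X f g = trans (sum-cong-≗ pointwise) (∑-distrib-+ (λ u → if X u then f u else 0) _)
  where
  pointwise : ∀ u → (if X u then f u + g u else 0) ≡ (if X u then f u else 0) + (if X u then g u else 0)
  pointwise u with X u
  ... | true = refl
  ... | false = refl

∑-* : (X : Subset n) (c : ℕ) (f : Fin n → ℕ) → ∑[ u ∈ X ] (c * f u) ≡ c * ∑[ u ∈ X ] f u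
∑-* X c f = trans (sum-cong-≗ pointwise) (sym (*-distribˡ-sum c (λ u → if X u then f u else 0)))
  where
  pointwise : ∀ u → (if X u then c * f u else 0) ≡ c * (if X u then f u else 0)
  pointwise u with X u
  ... | true = refl
  ... | false = sym (*-zeroʳ c)

∑-const : (X : Subset n) (c : ℕ) → ∑[ _ ∈ X ] c ≡ ∣ X ∣ * c
∑-const X c = begin
  ∑[ _ ∈ X ] c        ≡⟨ ∑-cong {X = X} (λ _ _ → sym (*-identityʳ c)) ⟩
  ∑[ _ ∈ X ] (c * 1)  ≡⟨ ∑-* X c (λ _ → 1) ⟩
  c * ∣ X ∣           ≡⟨ *-comm c ∣ X ∣ ⟩
  ∣ X ∣ * c           ∎
  where open ≡-Reasoning

∑-zero : (∀ u → u ∈ X → f u ≡ 0) → ∑[ u ∈ X ] f u ≡ 0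
∑-zero {X = X} f≡0 = trans (∑-cong f≡0) (trans (∑-const X 0) (*-zeroʳ ∣ X ∣))

∑-≤-∣∣* : (c : ℕ) → (∀ u → u ∈ X → f u ≤ c) → ∑[ u ∈ X ] f u ≤ ∣ X ∣ * c
∑-≤-∣∣* {X = X} c f≤c = ≤-trans (∑-mono-≤ f≤c) (≤-reflexive (∑-const X c))

∣full∣ : ∀ n → ∣ full {n} ∣ ≡ n
∣full∣ n = trans (sum-const {n} 1) (*-identityʳ n)

∣─∣ : (X : Subset n) → v ∈ X → ∣ X ∣ ≡ suc ∣ X ─ v ∣
∣─∣ X = ∑-remove X (λ _ → 1)

∃∈? : (X : Subset n) → Dec (∃ λ u → u ∈ X)
∃∈? X = any? (_∈? X)

∄∈⇒∣∣≡0 : (X : Subset n) → ¬ (∃ λ u → u ∈ X) → ∣ X ∣ ≡ 0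
∄∈⇒∣∣≡0 X ∄ = ∑-zero {X = X} λ u u∈X → ⊥-elim (∄ (u , u∈X))

∣∣≡0⇒∉ : (X : Subset n) → ∣ X ∣ ≡ 0 → ¬ u ∈ X
∣∣≡0⇒∉ X ∣X∣≡0 u∈X with () ← trans (sym (∣─∣ X u∈X)) ∣X∣≡0

∣∣>0⇒∃∈ : (X : Subset n) → 0 < ∣ X ∣ → ∃ λ u → u ∈ X
∣∣>0⇒∃∈ X 0<∣X∣ with ∃∈? X
... | yes ∃ = ∃
... | no ∄ = ⊥-elim (<⇒≢ 0<∣X∣ (sym (∄∈⇒∣∣≡0 X ∄)))

subsingleton⇒∣∣≤1 : (X : Subset n) → (∀ x y → x ∈ X → y ∈ X → x ≡ y) → ∣ X ∣ ≤ 1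
subsingleton⇒∣∣≤1 X unique with ∃∈? X
... | no ∄ = subst (_≤ 1) (sym (∄∈⇒∣∣≡0 X ∄)) z≤n
... | yes (x , x∈X) = ≤-reflexive (trans (∣─∣ X x∈X) (cong suc (∑-zero {X = X ─ x} only-x)))
  where
  only-x : ∀ y → y ∈ X ─ x → 1 ≡ 0
  only-x y y∈ = ⊥-elim (proj₂ (∈─⁻ y∈) (unique y x (proj₁ (∈─⁻ y∈)) x∈X))

argmin-∈ : (f : Fin n → ℕ) → u ∈ X → ∃ λ v → v ∈ X × (∀ w → w ∈ X → f v ≤ f w)
argmin-∈ {n} {u} {X} f u∈X =
  minimiser , argmin-all f {xs = members} u∈X (all-filter (_∈? X) (List.allFin n)) , minimal
  where
  members : List.List (Fin n)
  members = List.filter (_∈? X) (List.allFin n)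
  minimiser : Fin n
  minimiser = argmin f u members
  minimal : ∀ w → w ∈ X → f minimiser ≤ f w
  minimal w w∈X = All.lookup (f[argmin]≤f[xs] u members) (∈-filter⁺ (_∈? X) (∈-allFin w) w∈X)

blockArc : ℕ → ℕ → Bool
blockArc a b = not (a ≡ᵇ b) ∧ (a / 2 ≤ᵇ b / 2)

BlockArc : ℕ → ℕ → Set
BlockArc a b = a ≢ b × ⌊ a /2⌋ ≤ ⌊ b /2⌋

blockArc? : ∀ a b → Dec (BlockArc a b)
blockArc? a b = ¬? (a ℕ.≟ b) ×-dec (⌊ a /2⌋ ℕ.≤? ⌊ b /2⌋)

/2≡⌊/2⌋ : ∀ a → a / 2 ≡ ⌊ a /2⌋
/2≡⌊/2⌋ 0 = refl
/2≡⌊/2⌋ 1 = refl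
/2≡⌊/2⌋ (suc (suc a)) =
  trans (m/n≡1+[m∸n]/n {suc (suc a)} {2} (s≤s (s≤s z≤n))) (cong suc (/2≡⌊/2⌋ a))

blockArc≡does : ∀ a b → blockArc a b ≡ does (blockArc? a b)
blockArc≡does a b rewrite /2≡⌊/2⌋ a | /2≡⌊/2⌋ b = refl

blockArc-true : ∀ a b → BlockArc a b → blockArc a b ≡ true
blockArc-true a b arc = trans (blockArc≡does a b) (dec-true (blockArc? a b) arc)

blockArc-false : ∀ a b → ¬ BlockArc a b → blockArc a b ≡ false
blockArc-false a b ¬arc = trans (blockArc≡does a b) (dec-false (blockArc? a b) ¬arc)

blockArc-sound : ∀ {a b} → blockArc a b ≡ true → BlockArc a b
blockArc-sound {a} {b} arc with blockArc? a b
... | yes a→b = a→b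
... | no ¬a→b with () ← trans (sym arc) (blockArc-false a b ¬a→b)

blockArc-irrefl : ∀ a → blockArc a a ≡ false
blockArc-irrefl a = blockArc-false a a λ (a≢a , _) → a≢a refl

blockArc-< : ∀ {a b} → a < b → blockArc a b ≡ true
blockArc-< {a} {b} a<b = blockArc-true a b (<⇒≢ a<b , ⌊n/2⌋-mono (<⇒≤ a<b))

blockArc-total : ∀ {a b} → a ≢ b → blockArc a b ≡ false → blockArc b a ≡ false → ⊥
blockArc-total {a} {b} a≢b ab ba with ≤-total ⌊ a /2⌋ ⌊ b /2⌋
... | inj₁ ≤ with () ← trans (sym ab) (blockArc-true a b (a≢b , ≤))
... | inj₂ ≥ with () ← trans (sym ba) (blockArc-true b a (a≢b ∘ sym , ≥))

blockArc-shift : ∀ a b → blockArc (2 + a) (2 + b) ≡ blockArc a b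
blockArc-shift a b = begin
  blockArc (2 + a) (2 + b)          ≡⟨ blockArc≡does (2 + a) (2 + b) ⟩
  does (blockArc? (2 + a) (2 + b))  ≡⟨ does-⇔ (mk⇔ unshift shift) (blockArc? _ _) (blockArc? a b) ⟩
  does (blockArc? a b)              ≡⟨ blockArc≡does a b ⟨
  blockArc a b                      ∎
  where
  open ≡-Reasoning
  unshift : BlockArc (2 + a) (2 + b) → BlockArc a b
  unshift (a≢b , a/2≤b/2) = a≢b ∘ cong (2 +_) , ≤-pred a/2≤b/2
  shift : BlockArc a b → BlockArc (2 + a) (2 + b)
  shift (a≢b , a/2≤b/2) = a≢b ∘ suc-injective ∘ suc-injective , s≤s a/2≤b/2

blockArc-backwards : ∀ a → blockArc (2 + a) 0 ≡ false × blockArc (2 + a) 1 ≡ false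
blockArc-backwards a = blockArc-false (2 + a) 0 (λ ()) , blockArc-false (2 + a) 1 (λ ())

⌊2*j/2⌋≡j : ∀ j → ⌊ 2 * j /2⌋ ≡ j
⌊2*j/2⌋≡j zero = refl
⌊2*j/2⌋≡j (suc j) = trans (cong ⌊_/2⌋ (*-suc 2 j)) (cong suc (⌊2*j/2⌋≡j j))

⌊1+2*j/2⌋≡j : ∀ j → ⌊ suc (2 * j) /2⌋ ≡ j
⌊1+2*j/2⌋≡j zero = refl
⌊1+2*j/2⌋≡j (suc j) = trans (cong (⌊_/2⌋ ∘ suc) (*-suc 2 j)) (cong suc (⌊1+2*j/2⌋≡j j))

<2*j⇒⌊/2⌋< : ∀ {b j} → b < 2 * j → ⌊ b /2⌋ < j
<2*j⇒⌊/2⌋< {b} {j} b<2j = subst (suc ⌊ b /2⌋ ≤_) (⌊1+2*j/2⌋≡j j) (⌊n/2⌋-mono (s≤s b<2j))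

blockArc-below : ∀ {a b} j → ⌊ a /2⌋ ≡ j → b < 2 * j → blockArc a b ≡ false
blockArc-below {a} {b} j a/2≡j b<2j = blockArc-false a b λ (_ , a/2≤b/2) →
  <⇒≱ (<2*j⇒⌊/2⌋< b<2j) (subst (_≤ ⌊ b /2⌋) a/2≡j a/2≤b/2)

blockArc-partner : ∀ j → blockArc (suc (2 * j)) (2 * j) ≡ true
blockArc-partner j = blockArc-true (suc (2 * j)) (2 * j)
  (1+n≢n , ≤-reflexive (trans (⌊1+2*j/2⌋≡j j) (sym (⌊2*j/2⌋≡j j))))

blockmate : ℕ → ℕ
blockmate 0 = 1
blockmate 1 = 0
blockmate (suc (suc a)) = suc (suc (blockmate a))

same-block⇒blockmate : ∀ a b → ⌊ a /2⌋ ≡ ⌊ b /2⌋ → a ≢ b → b ≡ blockmate a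
same-block⇒blockmate 0 0 _ a≢b = ⊥-elim (a≢b refl)
same-block⇒blockmate 0 1 _ _ = refl
same-block⇒blockmate 1 0 _ _ = refl
same-block⇒blockmate 1 1 _ a≢b = ⊥-elim (a≢b refl)
same-block⇒blockmate (suc (suc a)) (suc (suc b)) a~b a≢b =
  cong (2 +_) (same-block⇒blockmate a b (suc-injective a~b) (a≢b ∘ cong (2 +_)))
same-block⇒blockmate 0 (suc (suc b)) () _
same-block⇒blockmate 1 (suc (suc b)) () _
same-block⇒blockmate (suc (suc a)) 0 () _
same-block⇒blockmate (suc (suc a)) 1 () _

[_] : Bool → ℕ
[ b ] = if b then 1 else 0

[]≤1 : ∀ b → [ b ] ≤ 1
[]≤1 true = ≤-refl
[]≤1 false = z≤n

[]+[]≤1 : ∀ {a b} → (a ≡ true → b ≡ true → ⊥) → [ a ] + [ b ] ≤ 1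
[]+[]≤1 {true} {true} ¬both = ⊥-elim (¬both refl refl)
[]+[]≤1 {true} {false} _ = ≤-refl
[]+[]≤1 {false} {b} _ = []≤1 b

N⁺ N⁻ : Digraph n → Fin n → Subset n
N⁺ G v = G v
N⁻ G v u = G u v

module _ {n : ℕ} (G : Digraph n) where

  outdegIn : Subset n → Fin n → ℕ
  outdegIn A u = ∑[ w ∈ A ] [ G u w ]

  arcsIn : Subset n → ℕ
  arcsIn A = ∑[ u ∈ A ] outdegIn A u

  M1In : Subset n → ℕ
  M1In A = ∑[ u ∈ A ] (outdegIn A u * outdegIn A u)

  adjacency : Fin n → Fin n → ℕ
  adjacency x w = [ G x w ] + [ G w x ]

  M1≡M1In-full : M1 G ≡ M1In full
  M1≡M1In-full = trans (sum-map-allFin (λ u → outdeg G u ^ 2)) (sum-cong-≗ λ u → begin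
    outdeg G u ^ 2                     ≡⟨ cong (outdeg G u *_) (*-identityʳ (outdeg G u)) ⟩
    outdeg G u * outdeg G u            ≡⟨ cong (λ d → d * d) (sum-map-allFin (λ w → [ G u w ])) ⟩
    outdegIn full u * outdegIn full u  ∎)
    where open ≡-Reasoning

  outdegIn-─ : (A : Subset n) {v : Fin n} → v ∈ A →
               ∀ u → outdegIn A u ≡ [ G u v ] + outdegIn (A ─ v) u
  outdegIn-─ A v∈A u = ∑-remove A (λ w → [ G u w ]) v∈A

  outdegIn-≤ : ∀ A u → outdegIn A u ≤ ∣ A ∣
  outdegIn-≤ A u =
    subst (outdegIn A u ≤_) (*-identityʳ ∣ A ∣) (∑-≤-∣∣* {X = A} 1 λ w _ → []≤1 (G u w))

  outdegIn-split : ∀ A B u → outdegIn A u ≡ outdegIn (A ∩ B) u + outdegIn (A ∖ B) u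
  outdegIn-split A B u = ∑-split A B (λ w → [ G u w ])

  outdegIn≡∣∩N⁺∣ : ∀ A u → outdegIn A u ≡ ∣ A ∩ N⁺ G u ∣
  outdegIn≡∣∩N⁺∣ A u = sym (∑-∩ A (G u) (λ _ → 1))

  M1In-─ : (S : Subset n) {v : Fin n} → v ∈ S →
           M1In S ≡ M1In (S ─ v) + (outdegIn S v * outdegIn S v
                                    + ∑[ u ∈ S ─ v ∩ N⁻ G v ] (2 * outdegIn (S ─ v) u + 1))
  M1In-─ S {v} v∈S = begin
    M1In S
      ≡⟨ ∑-remove S _ v∈S ⟩
    δ * δ + ∑[ u ∈ S' ] (outdegIn S u * outdegIn S u)
      ≡⟨ cong (δ * δ +_) (∑-cong {X = S'} square-step) ⟩
    δ * δ + ∑[ u ∈ S' ] (outdegIn S' u * outdegIn S' u + gain u)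
      ≡⟨ cong (δ * δ +_) (∑-+ S' _ gain) ⟩
    δ * δ + (M1In S' + ∑[ u ∈ S' ] gain u)
      ≡⟨ cong (λ x → δ * δ + (M1In S' + x)) gain-∩ ⟩
    δ * δ + (M1In S' + Δ)
      ≡⟨ x∙yz≈y∙xz (δ * δ) _ Δ ⟩
    M1In S' + (δ * δ + Δ)
      ∎
    where
    open ≡-Reasoning
    S' : Subset n
    S' = S ─ v
    δ Δ : ℕ
    δ = outdegIn S v
    Δ = ∑[ u ∈ S' ∩ N⁻ G v ] (2 * outdegIn S' u + 1)
    gain : Fin n → ℕ
    gain u = if G u v then 2 * outdegIn S' u + 1 else 0
    gain-∩ : ∑[ u ∈ S' ] gain u ≡ Δ
    gain-∩ = sym (∑-∩ S' (N⁻ G v) (λ u → 2 * outdegIn S' u + 1))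
    square-expand : ∀ b x → ([ b ] + x) * ([ b ] + x) ≡ x * x + (if b then 2 * x + 1 else 0)
    square-expand true = expand
      where
      expand : ∀ x → (1 + x) * (1 + x) ≡ x * x + (2 * x + 1)
      expand = solve-∀
    square-expand false x = sym (+-identityʳ (x * x))
    square-step : ∀ u → u ∈ S' → outdegIn S u * outdegIn S u ≡ outdegIn S' u * outdegIn S' u + gain u
    square-step u _ rewrite outdegIn-─ S v∈S u = square-expand (G u v) (outdegIn S' u)

  arcsIn-─ : Loopless G → (A : Subset n) {x : Fin n} → x ∈ A →
             arcsIn A ≡ arcsIn (A ─ x) + ∑[ w ∈ A ─ x ] adjacency x w
  arcsIn-─ loopless A {x} x∈A = begin
    ∑[ u ∈ A ] outdegIn A u
      ≡⟨ ∑-remove A (outdegIn A) x∈A ⟩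
    outdegIn A x + ∑[ u ∈ A' ] outdegIn A u
      ≡⟨ cong₂ _+_ out-x (∑-cong {X = A'} λ u _ → outdegIn-─ A x∈A u) ⟩
    out + ∑[ w ∈ A' ] (into w + outdegIn A' w)
      ≡⟨ cong (out +_) (∑-+ A' into (outdegIn A')) ⟩
    out + (∑[ w ∈ A' ] into w + arcsIn A')
      ≡⟨ +-assoc out _ (arcsIn A') ⟨
    out + ∑[ w ∈ A' ] into w + arcsIn A'
      ≡⟨ cong (_+ arcsIn A') (∑-+ A' (λ w → [ G x w ]) into) ⟨
    ∑[ w ∈ A' ] adjacency x w + arcsIn A'
      ≡⟨ +-comm _ (arcsIn A') ⟩
    arcsIn A' + ∑[ w ∈ A' ] adjacency x w
      ∎
    where
    open ≡-Reasoning
    A' : Subset n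
    A' = A ─ x
    out : ℕ
    out = outdegIn A' x
    into : Fin n → ℕ
    into w = [ G w x ]
    out-x : outdegIn A x ≡ out
    out-x rewrite outdegIn-─ A x∈A x | loopless x = refl

-- Induced copies of F

record FRanking (G : Digraph n) (S : Subset n) (r : Fin n → ℕ) : Set where
  field
    rank-< : ∀ u → u ∈ S → r u < ∣ S ∣
    rank-injective : ∀ u w → u ∈ S → w ∈ S → r u ≡ r w → u ≡ w
    rank-surjective : ∀ j → j < ∣ S ∣ → ∃ λ u → u ∈ S × r u ≡ j
    rank-arcs : ∀ u w → u ∈ S → w ∈ S → G u w ≡ blockArc (r u) (r w)

empty-FRanking : (G : Digraph n) (S : Subset n) → ∣ S ∣ ≡ 0 → FRanking G S (λ _ → 0)
empty-FRanking G S ∣S∣≡0 = record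
  { rank-< = λ u u∈S → ⊥-elim (∉S u∈S)
  ; rank-injective = λ u _ u∈S _ _ → ⊥-elim (∉S u∈S)
  ; rank-surjective = λ j j<∣S∣ → ⊥-elim (n≮0 (subst (j <_) ∣S∣≡0 j<∣S∣))
  ; rank-arcs = λ u _ u∈S _ → ⊥-elim (∉S u∈S)
  }
  where
  ∉S : ∀ {u} → ¬ u ∈ S
  ∉S = ∣∣≡0⇒∉ S ∣S∣≡0

FRanking-full⇒≅ : (G : Digraph n) {r : Fin n → ℕ} → FRanking G full r → G ≅ F n
FRanking-full⇒≅ {n} G {r} ranked = mk↔ₛ′ to from to∘from from∘to , preserves
  where
  open FRanking ranked
  r<n : ∀ u → r u < n
  r<n u = subst (r u <_) (∣full∣ n) (rank-< u refl)
  to : Fin n → Fin n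
  to u = fromℕ< (r<n u)
  preimage : ∀ j → ∃ λ u → u ∈ full × r u ≡ toℕ j
  preimage j = rank-surjective (toℕ j) (subst (toℕ j <_) (sym (∣full∣ n)) (toℕ<n j))
  from : Fin n → Fin n
  from j = proj₁ (preimage j)
  to∘from : ∀ j → to (from j) ≡ j
  to∘from j = toℕ-injective (trans (toℕ-fromℕ< (r<n (from j))) (proj₂ (proj₂ (preimage j))))
  from∘to : ∀ u → from (to u) ≡ u
  from∘to u = rank-injective (from (to u)) u refl refl
                             (trans (proj₂ (proj₂ (preimage (to u)))) (toℕ-fromℕ< (r<n u)))
  preserves : ∀ u w → G u w ≡ F n (to u) (to w)
  preserves u w =
    trans (rank-arcs u w refl refl) (sym (cong₂ blockArc (toℕ-fromℕ< (r<n u)) (toℕ-fromℕ< (r<n w))))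

-- Digraphs without loops and directed triangles

module C3Free {n : ℕ} {G : Digraph n} (loopless : Loopless G) (noC3 : ¬ HasC3 G) where

  arc⇒≢ : ∀ {a b} → Arc G a b → a ≢ b
  arc⇒≢ {a} a→a refl with () ← trans (sym a→a) (loopless a)

  no-triangle : ∀ {a b c} → Arc G a b → Arc G b c → Arc G c a → ⊥
  no-triangle {a} {b} {c} ab bc ca =
    noC3 (a , b , c , arc⇒≢ ab , arc⇒≢ bc , arc⇒≢ ca ∘ sym , ab , bc , ca)

  digon-adjacency : ∀ {x y} → Arc G x y → Arc G y x → ∀ w → adjacency G x w + adjacency G y w ≤ 2
  digon-adjacency {x} {y} xy yx w = begin
    adjacency G x w + adjacency G y w
      ≡⟨ regroup [ G x w ] [ G w x ] [ G y w ] [ G w y ] ⟩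
    ([ G x w ] + [ G w y ]) + ([ G y w ] + [ G w x ])
      ≤⟨ +-mono-≤ ([]+[]≤1 λ xw wy → no-triangle xw wy yx)
                  ([]+[]≤1 λ yw wx → no-triangle yw wx xy) ⟩
    2
      ∎
    where
    open ≤-Reasoning
    regroup : ∀ a b c d → (a + b) + (c + d) ≡ (a + d) + (c + b)
    regroup = solve-∀

  digon? : (A : Subset n) → Dec (∃ λ x → ∃ λ y → x ∈ A × y ∈ A × Arc G x y × Arc G y x)
  digon? A = any? λ x → any? λ y →
    (x ∈? A) ×-dec (y ∈? A) ×-dec (G x y Bool.≟ true) ×-dec (G y x Bool.≟ true)

  ArcBound : Subset n → Set
  ArcBound A = 2 * arcsIn G A ≤ ∣ A ∣ * ∣ A ∣

  SmallerArcBounds : Subset n → Set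
  SmallerArcBounds = WfRec (_<_ on ∣_∣) ArcBound

  vertex-step : (A : Subset n) {x : Fin n} → x ∈ A →
                (∀ w → w ∈ A ─ x → adjacency G x w ≤ 1) → SmallerArcBounds A → ArcBound A
  vertex-step A {x} x∈A adj≤1 IH = begin
    2 * arcsIn G A                                 ≡⟨ cong (2 *_) (arcsIn-─ G loopless A x∈A) ⟩
    2 * (arcsIn G A' + adj)                        ≡⟨ *-distribˡ-+ 2 (arcsIn G A') adj ⟩
    2 * arcsIn G A' + 2 * adj                      ≤⟨ +-mono-≤ (IH k<∣A∣) (*-monoʳ-≤ 2 adj≤k*1) ⟩
    k * k + 2 * (k * 1)                            <⟨ n<1+n _ ⟩
    suc (k * k + 2 * (k * 1))                      ≡⟨ expand k ⟩
    suc k * suc k                                  ≡⟨ cong (λ m → m * m) size ⟨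
    ∣ A ∣ * ∣ A ∣                                  ∎
    where
    open ≤-Reasoning
    A' : Subset n
    A' = A ─ x
    adj k : ℕ
    adj = ∑[ w ∈ A' ] adjacency G x w
    k = ∣ A' ∣
    adj≤k*1 : adj ≤ k * 1
    adj≤k*1 = ∑-≤-∣∣* 1 adj≤1
    size : ∣ A ∣ ≡ suc k
    size = ∣─∣ A x∈A
    k<∣A∣ : k < ∣ A ∣
    k<∣A∣ = ≤-reflexive (sym size)
    expand : ∀ k → suc (k * k + 2 * (k * 1)) ≡ suc k * suc k
    expand = solve-∀

  digon-step : (A : Subset n) {x y : Fin n} → x ∈ A → y ∈ A → Arc G x y → Arc G y x →
               SmallerArcBounds A → ArcBound A
  digon-step A {x} {y} x∈A y∈A xy yx IH = begin
    2 * arcsIn G A                                 ≡⟨ cong (2 *_) arcs-split ⟩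
    2 * (arcsIn G A'' + 2 + ∑[ w ∈ A'' ] adj₂ w)   ≡⟨ distrib (arcsIn G A'') _ ⟩
    2 * arcsIn G A'' + 4 + 2 * ∑[ w ∈ A'' ] adj₂ w ≤⟨ +-mono-≤ (+-monoˡ-≤ 4 (IH k<∣A∣))
                                                               (*-monoʳ-≤ 2 adj₂≤k*2) ⟩
    k * k + 4 + 2 * (k * 2)                        ≡⟨ expand k ⟩
    suc (suc k) * suc (suc k)                      ≡⟨ cong (λ m → m * m) size ⟨
    ∣ A ∣ * ∣ A ∣                                  ∎
    where
    open ≤-Reasoning
    A' A'' : Subset n
    A' = A ─ x
    A'' = A' ─ y
    k adj-x adj-y : ℕ
    k = ∣ A'' ∣
    adj-x = ∑[ w ∈ A'' ] adjacency G x w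
    adj-y = ∑[ w ∈ A'' ] adjacency G y w
    adj₂ : Fin n → ℕ
    adj₂ w = adjacency G x w + adjacency G y w
    adj₂≤k*2 : ∑[ w ∈ A'' ] adj₂ w ≤ k * 2
    adj₂≤k*2 = ∑-≤-∣∣* 2 λ w _ → digon-adjacency xy yx w
    y∈A' : y ∈ A'
    y∈A' = ∈─⁺ y∈A (arc⇒≢ xy ∘ sym)
    size : ∣ A ∣ ≡ suc (suc k)
    size = trans (∣─∣ A x∈A) (cong suc (∣─∣ A' y∈A'))
    k<∣A∣ : k < ∣ A ∣
    k<∣A∣ = subst (k <_) (sym size) (m<n⇒m<1+n (n<1+n k))
    adj-xy : adjacency G x y ≡ 2
    adj-xy rewrite xy | yx = refl
    regroup : ∀ e a b → (e + a) + (2 + b) ≡ e + 2 + (b + a)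
    regroup = solve-∀
    arcs-split : arcsIn G A ≡ arcsIn G A'' + 2 + ∑[ w ∈ A'' ] adj₂ w
    arcs-split = begin-equality
      arcsIn G A
        ≡⟨ arcsIn-─ G loopless A x∈A ⟩
      arcsIn G A' + ∑[ w ∈ A' ] adjacency G x w
        ≡⟨ cong₂ _+_ (arcsIn-─ G loopless A' y∈A') (∑-remove A' _ y∈A') ⟩
      (arcsIn G A'' + adj-y) + (adjacency G x y + adj-x)
        ≡⟨ cong (λ a → (arcsIn G A'' + adj-y) + (a + adj-x)) adj-xy ⟩
      (arcsIn G A'' + adj-y) + (2 + adj-x)
        ≡⟨ regroup (arcsIn G A'') adj-y adj-x ⟩
      arcsIn G A'' + 2 + (adj-x + adj-y)
        ≡⟨ cong (arcsIn G A'' + 2 +_) (∑-+ A'' _ _) ⟨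
      arcsIn G A'' + 2 + ∑[ w ∈ A'' ] adj₂ w
        ∎
    distrib : ∀ e s → 2 * (e + 2 + s) ≡ 2 * e + 4 + 2 * s
    distrib = solve-∀
    expand : ∀ k → k * k + 4 + 2 * (k * 2) ≡ suc (suc k) * suc (suc k)
    expand = solve-∀

  2*arcsIn≤∣∣² : (A : Subset n) → ArcBound A
  2*arcsIn≤∣∣² = wfRec ArcBound bound
    where
    open WF.All (On.wellFounded ∣_∣ <-wellFounded) 0ℓ
    bound : ∀ A → SmallerArcBounds A → ArcBound A
    bound A IH with digon? A | ∃∈? A
    ... | yes (x , y , x∈A , y∈A , xy , yx) | _ = digon-step A x∈A y∈A xy yx IH
    ... | no ¬digon | yes (x , x∈A) = vertex-step A x∈A adj≤1 IH
      where
      adj≤1 : ∀ w → w ∈ A ─ x → adjacency G x w ≤ 1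
      adj≤1 w w∈ = []+[]≤1 λ xw wx → ¬digon (x , w , x∈A , proj₁ (∈─⁻ w∈) , xw , wx)
    ... | no _ | no ∄ = subst (λ m → 2 * m ≤ ∣ A ∣ * ∣ A ∣) (sym no-arcs) z≤n
      where
      no-arcs : arcsIn G A ≡ 0
      no-arcs = ∑-zero {X = A} λ u u∈A → ⊥-elim (∄ (u , u∈A))

  module MinOutdegree (S : Subset n) {v : Fin n} (v∈S : v ∈ S)
                      (v-min : ∀ u → u ∈ S → outdegIn G S v ≤ outdegIn G S u) where

    S' I T B P Γ : Subset n
    S' = S ─ v
    I = S' ∩ N⁻ G v
    T = S' ∖ N⁻ G v
    B = I ∩ N⁺ G v
    P = I ∖ N⁺ G v
    Γ = T ∩ N⁺ G v

    δ gain : ℕ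
    δ = outdegIn G S v
    gain = δ * δ + ∑[ u ∈ I ] (2 * outdegIn G S' u + 1)

    ∣S∣≡ : ∣ S ∣ ≡ suc ∣ S' ∣
    ∣S∣≡ = ∣─∣ S v∈S

    ∣S'∣<∣S∣ : ∣ S' ∣ < ∣ S ∣
    ∣S'∣<∣S∣ = ≤-reflexive (sym ∣S∣≡)

    3*M1In-S : 3 * M1In G S ≡ 3 * M1In G S' + 3 * gain
    3*M1In-S = trans (cong (3 *_) (M1In-─ G S v∈S)) (*-distribˡ-+ 3 (M1In G S') gain)

    ∣I∣≡ : ∣ I ∣ ≡ ∣ B ∣ + ∣ P ∣
    ∣I∣≡ = ∑-split I (N⁺ G v) (λ _ → 1)

    ∣S'∣≡ : ∣ S' ∣ ≡ ∣ B ∣ + ∣ P ∣ + ∣ T ∣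
    ∣S'∣≡ = trans (∑-split S' (N⁻ G v) (λ _ → 1)) (cong (_+ ∣ T ∣) ∣I∣≡)

    δ≡∣B∣+∣Γ∣ : δ ≡ ∣ B ∣ + ∣ Γ ∣
    δ≡∣B∣+∣Γ∣ = begin
      outdegIn G S v
        ≡⟨ outdegIn-─ G S v∈S v ⟩
      [ G v v ] + outdegIn G S' v
        ≡⟨ cong (λ b → [ b ] + outdegIn G S' v) (loopless v) ⟩
      outdegIn G S' v
        ≡⟨ outdegIn-split G S' (N⁻ G v) v ⟩
      outdegIn G I v + outdegIn G T v
        ≡⟨ cong₂ _+_ (outdegIn≡∣∩N⁺∣ G I v) (outdegIn≡∣∩N⁺∣ G T v) ⟩
      ∣ B ∣ + ∣ Γ ∣
        ∎
      where open ≡-Reasoning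

    -- If v → y for some y ∈ T, every out-neighbour u of y lies in T (else v → y → u → v),
    -- so minimality of δ gives δ ≤ d(y) ≤ |T|.
    δ²≤ : δ * δ ≤ ∣ B ∣ * ∣ B ∣ + ∣ T ∣ * ∣ T ∣
    δ²≤ with ∃∈? Γ
    ... | no ∄ = begin
      δ * δ                          ≡⟨ cong (λ d → d * d) δ≡∣B∣ ⟩
      ∣ B ∣ * ∣ B ∣                  ≤⟨ m≤m+n _ _ ⟩
      ∣ B ∣ * ∣ B ∣ + ∣ T ∣ * ∣ T ∣  ∎
      where
      open ≤-Reasoning
      δ≡∣B∣ : δ ≡ ∣ B ∣
      δ≡∣B∣ = trans δ≡∣B∣+∣Γ∣ (trans (cong (∣ B ∣ +_) (∄∈⇒∣∣≡0 Γ ∄))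
                                   (+-identityʳ _))
    ... | yes (y , y∈Γ) = ≤-trans (*-mono-≤ δ≤∣T∣ δ≤∣T∣) (m≤n+m _ _)
      where
      y∈T : y ∈ T
      y∈T = proj₁ (∈∩⁻ y∈Γ)
      v→y : Arc G v y
      v→y = proj₂ (∈∩⁻ {X = T} y∈Γ)
      y↛v : G y v ≡ false
      y↛v = proj₂ (∈∖⁻ {X = S'} y∈T)
      out-y⊆T : ∀ u → u ∈ S ∩ N⁺ G y → u ∈ T
      out-y⊆T u u∈ =
        ∈∖⁺ (∈─⁺ (proj₁ (∈∩⁻ u∈)) u≢v)
            (Bool.¬-not λ u→v → no-triangle v→y y→u u→v)
        where
        y→u : Arc G y u
        y→u = proj₂ (∈∩⁻ {X = S} u∈)
        u≢v : u ≢ v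
        u≢v refl with () ← trans (sym y→u) y↛v
      δ≤∣T∣ : δ ≤ ∣ T ∣
      δ≤∣T∣ = begin
        δ                ≤⟨ v-min y (proj₁ (∈─⁻ (proj₁ (∈∖⁻ y∈T)))) ⟩
        outdegIn G S y   ≡⟨ outdegIn≡∣∩N⁺∣ G S y ⟩
        ∣ S ∩ N⁺ G y ∣   ≤⟨ ∑-⊆ out-y⊆T ⟩
        ∣ T ∣            ∎
        where open ≤-Reasoning

    B-into-I : ∀ x → x ∈ B → outdegIn G I x ≡ 0
    B-into-I x x∈B = ∑-zero {X = I} λ u u∈I → cong [_] (Bool.¬-not λ x→u →
      no-triangle (proj₂ (∈∩⁻ {X = I} x∈B)) x→u (proj₂ (∈∩⁻ {X = S'} u∈I)))

    outdeg-from-I : ∑[ u ∈ I ] outdegIn G S' u ≤ arcsIn G P + ∣ P ∣ * ∣ B ∣ + ∣ I ∣ * ∣ T ∣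
    outdeg-from-I = begin
      ∑[ u ∈ I ] outdegIn G S' u
        ≡⟨ ∑-cong (λ u _ → outdegIn-split G S' (N⁻ G v) u) ⟩
      ∑[ u ∈ I ] (outdegIn G I u + outdegIn G T u)
        ≡⟨ ∑-+ I (outdegIn G I) (outdegIn G T) ⟩
      arcsIn G I + I-to-T
        ≤⟨ +-monoʳ-≤ (arcsIn G I) I-to-T≤ ⟩
      arcsIn G I + ∣ I ∣ * ∣ T ∣
        ≡⟨ cong (_+ ∣ I ∣ * ∣ T ∣) arcs-I ⟩
      arcsIn G P + P-to-B + ∣ I ∣ * ∣ T ∣
        ≤⟨ +-monoˡ-≤ (∣ I ∣ * ∣ T ∣) (+-monoʳ-≤ (arcsIn G P) P-to-B≤) ⟩
      arcsIn G P + ∣ P ∣ * ∣ B ∣ + ∣ I ∣ * ∣ T ∣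
        ∎
      where
      open ≤-Reasoning
      I-to-T P-to-B : ℕ
      I-to-T = ∑[ u ∈ I ] outdegIn G T u
      P-to-B = ∑[ u ∈ P ] outdegIn G B u
      I-to-T≤ : I-to-T ≤ ∣ I ∣ * ∣ T ∣
      I-to-T≤ = ∑-≤-∣∣* ∣ T ∣ λ u _ → outdegIn-≤ G T u
      P-to-B≤ : P-to-B ≤ ∣ P ∣ * ∣ B ∣
      P-to-B≤ = ∑-≤-∣∣* ∣ B ∣ λ u _ → outdegIn-≤ G B u
      arcs-I : arcsIn G I ≡ arcsIn G P + P-to-B
      arcs-I = begin-equality
        arcsIn G I
          ≡⟨ ∑-split I (N⁺ G v) (outdegIn G I) ⟩
        ∑[ u ∈ B ] outdegIn G I u + ∑[ u ∈ P ] outdegIn G I u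
          ≡⟨ cong (_+ ∑[ u ∈ P ] outdegIn G I u) (∑-zero B-into-I) ⟩
        ∑[ u ∈ P ] outdegIn G I u
          ≡⟨ ∑-cong (λ u _ → outdegIn-split G I (N⁺ G v) u) ⟩
        ∑[ u ∈ P ] (outdegIn G B u + outdegIn G P u)
          ≡⟨ ∑-+ P (outdegIn G B) (outdegIn G P) ⟩
        P-to-B + arcsIn G P
          ≡⟨ +-comm P-to-B (arcsIn G P) ⟩
        arcsIn G P + P-to-B
          ∎

    gain+∣T∣≤ : gain + ∣ T ∣ ≤ ∣ S' ∣ * ∣ S' ∣ + ∣ S' ∣
    gain+∣T∣≤ = begin
      δ * δ + ∑[ u ∈ I ] (2 * outdegIn G S' u + 1) + t
        ≡⟨ cong (λ x → δ * δ + x + t) (trans (∑-+ I _ _) (cong₂ _+_ (∑-* I 2 _) ∣I∣≡)) ⟩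
      δ * δ + (2 * ∑[ u ∈ I ] outdegIn G S' u + (b + p)) + t
        ≤⟨ +-monoˡ-≤ t (+-mono-≤ δ²≤ (+-monoˡ-≤ (b + p) (*-monoʳ-≤ 2 outdeg-from-I′))) ⟩
      b * b + t * t + (2 * (e + p * b + (b + p) * t) + (b + p)) + t
        ≡⟨ regroup b p t e ⟩
      2 * e + (b * b + t * t + 2 * (p * b + (b + p) * t) + (b + p + t))
        ≤⟨ +-monoˡ-≤ _ (2*arcsIn≤∣∣² P) ⟩
      p * p + (b * b + t * t + 2 * (p * b + (b + p) * t) + (b + p + t))
        ≡⟨ square b p t ⟩
      (b + p + t) * (b + p + t) + (b + p + t)
        ≡⟨ cong (λ k → k * k + k) ∣S'∣≡ ⟨
      ∣ S' ∣ * ∣ S' ∣ + ∣ S' ∣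
        ∎
      where
      open ≤-Reasoning
      b p t e : ℕ
      b = ∣ B ∣
      p = ∣ P ∣
      t = ∣ T ∣
      e = arcsIn G P
      outdeg-from-I′ : ∑[ u ∈ I ] outdegIn G S' u ≤ e + p * b + (b + p) * t
      outdeg-from-I′ =
        subst (λ i → ∑[ u ∈ I ] outdegIn G S' u ≤ e + p * b + i * t) ∣I∣≡ outdeg-from-I
      regroup : ∀ b p t e → b * b + t * t + (2 * (e + p * b + (b + p) * t) + (b + p)) + t
                          ≡ 2 * e + (b * b + t * t + 2 * (p * b + (b + p) * t) + (b + p + t))
      regroup = solve-∀
      square : ∀ b p t → p * p + (b * b + t * t + 2 * (p * b + (b + p) * t) + (b + p + t))
                       ≡ (b + p + t) * (b + p + t) + (b + p + t)
      square = solve-∀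

    gain≤ : gain ≤ ∣ S' ∣ * ∣ S' ∣ + ∣ S' ∣
    gain≤ = m+n≤o⇒m≤o gain gain+∣T∣≤

    module Extremal (T-empty : ∣ T ∣ ≡ 0) (gain-tight : gain ≡ ∣ S' ∣ * ∣ S' ∣ + ∣ S' ∣)
                    {r : Fin n → ℕ} (ranked : FRanking G S' r) where

      open FRanking ranked

      k : ℕ
      k = ∣ S' ∣

      S'→v : ∀ u → u ∈ S' → Arc G u v
      S'→v u u∈S' with G u v in u→v
      ... | true = refl
      ... | false = ⊥-elim (∣∣≡0⇒∉ T T-empty (∈∖⁺ u∈S' u→v))

      B⊆S' : ∀ x → x ∈ B → x ∈ S'
      B⊆S' x x∈B = proj₁ (∈∩⁻ (proj₁ (∈∩⁻ x∈B)))

      B-sink : ∀ x → x ∈ B → ∀ u → u ∈ S' → G x u ≡ false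
      B-sink x x∈B u u∈S' =
        Bool.¬-not λ x→u → no-triangle (proj₂ (∈∩⁻ {X = I} x∈B)) x→u (S'→v u u∈S')

      v→w⇒w∈B : ∀ w → w ∈ S' → Arc G v w → w ∈ B
      v→w⇒w∈B w w∈S' v→w = ∈∩⁺ (∈∩⁺ w∈S' (S'→v w w∈S')) v→w

      -- Two distinct sinks of G[S'] would be joined by an arc, as in F.
      B-subsingleton : ∀ x y → x ∈ B → y ∈ B → x ≡ y
      B-subsingleton x y x∈B y∈B with x ≟ y
      ... | yes x≡y = x≡y
      ... | no x≢y = ⊥-elim (blockArc-total (x≢y ∘ rank-injective x y (B⊆S' x x∈B) (B⊆S' y y∈B))
                                            (no-arc x∈B y∈B) (no-arc y∈B x∈B))
        where
        no-arc : ∀ {a b} → a ∈ B → b ∈ B → blockArc (r a) (r b) ≡ false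
        no-arc {a} {b} a∈B b∈B =
          trans (sym (rank-arcs a b (B⊆S' a a∈B) (B⊆S' b b∈B))) (B-sink a a∈B b (B⊆S' b b∈B))

      δ≡∣B∣ : δ ≡ ∣ B ∣
      δ≡∣B∣ = trans δ≡∣B∣+∣Γ∣ (trans (cong (∣ B ∣ +_) ∣Γ∣≡0)
                                   (+-identityʳ ∣ B ∣))
        where
        ∣Γ∣≡0 : ∣ Γ ∣ ≡ 0
        Γ⊆T : ∀ u → u ∈ Γ → u ∈ T
        Γ⊆T _ u∈Γ = proj₁ (∈∩⁻ u∈Γ)
        ∣Γ∣≡0 = n≤0⇒n≡0 (subst (∣ Γ ∣ ≤_) T-empty (∑-⊆ Γ⊆T))

      δ≤1 : δ ≤ 1
      δ≤1 = subst (_≤ 1) (sym δ≡∣B∣) (subsingleton⇒∣∣≤1 B B-subsingleton)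

      δ²+2*arcs≡k² : δ * δ + 2 * arcsIn G S' ≡ k * k
      δ²+2*arcs≡k² = +-cancelʳ-≡ k _ _ (begin
        δ * δ + 2 * arcsIn G S' + k    ≡⟨ +-assoc (δ * δ) _ k ⟩
        δ * δ + (2 * arcsIn G S' + k)  ≡⟨ cong (δ * δ +_) gain-from-S' ⟨
        gain                           ≡⟨ gain-tight ⟩
        k * k + k                      ∎)
        where
        open ≡-Reasoning
        twice-outdeg+1 : Fin n → ℕ
        twice-outdeg+1 u = 2 * outdegIn G S' u + 1
        gain-from-S' : ∑[ u ∈ I ] twice-outdeg+1 u ≡ 2 * arcsIn G S' + k
        gain-from-S' = begin
          ∑[ u ∈ I ] twice-outdeg+1 u
            ≡⟨ ∑-∩ S' (N⁻ G v) twice-outdeg+1 ⟩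
          ∑[ u ∈ S' ] (if G u v then twice-outdeg+1 u else 0)
            ≡⟨ ∑-cong (λ u u∈S' →
                 cong (λ b → if b then twice-outdeg+1 u else 0) (S'→v u u∈S')) ⟩
          ∑[ u ∈ S' ] twice-outdeg+1 u
            ≡⟨ ∑-+ S' _ _ ⟩
          ∑[ u ∈ S' ] (2 * outdegIn G S' u) + k
            ≡⟨ cong (_+ k) (∑-* S' 2 (outdegIn G S')) ⟩
          2 * arcsIn G S' + k
            ∎

      δ-even : ∀ j → k ≡ 2 * j → δ ≡ 0
      δ-even j k≡2j with m≤n⇒m<n∨m≡n δ≤1
      ... | inj₁ δ<1 = n<1⇒n≡0 δ<1
      ... | inj₂ δ≡1 = ⊥-elim (even≢odd (j * (2 * j)) (arcsIn G S') (begin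
        2 * (j * (2 * j))          ≡⟨ *-assoc 2 j (2 * j) ⟨
        2 * j * (2 * j)            ≡⟨ cong (λ m → m * m) k≡2j ⟨
        k * k                      ≡⟨ δ²+2*arcs≡k² ⟨
        δ * δ + 2 * arcsIn G S'    ≡⟨ cong (λ d → d * d + 2 * arcsIn G S') δ≡1 ⟩
        suc (2 * arcsIn G S')      ∎))
        where open ≡-Reasoning

      δ-odd : ∀ j → k ≡ suc (2 * j) → δ ≡ 1
      δ-odd j k≡1+2j with m≤n⇒m<n∨m≡n δ≤1
      ... | inj₂ δ≡1 = δ≡1
      ... | inj₁ δ<1 = ⊥-elim (even≢odd (arcsIn G S') (2 * j * j + 2 * j) (begin
        2 * arcsIn G S'                ≡⟨ cong (λ d → d * d + 2 * arcsIn G S') (n<1⇒n≡0 δ<1) ⟨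
        δ * δ + 2 * arcsIn G S'        ≡⟨ δ²+2*arcs≡k² ⟩
        k * k                          ≡⟨ cong (λ m → m * m) k≡1+2j ⟩
        suc (2 * j) * suc (2 * j)      ≡⟨ expand j ⟩
        suc (2 * (2 * j * j + 2 * j))  ∎))
        where
        open ≡-Reasoning
        expand : ∀ j → suc (2 * j) * suc (2 * j) ≡ suc (2 * (2 * j * j + 2 * j))
        expand = solve-∀

      -- A sink of G[S'] can only carry the top rank 2 j of F_(2j+1).
      partner-rank : ∀ j {x} → k ≡ suc (2 * j) → x ∈ B → r x ≡ 2 * j
      partner-rank j {x} k≡1+2j x∈B =
        ≤-antisym (m<1+n⇒m≤n (subst (r x <_) k≡1+2j (rank-< x x∈S'))) (≮⇒≥ no-arc-up)
        where
        x∈S' : x ∈ S'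
        x∈S' = B⊆S' x x∈B
        arc-up : ∀ u → u ∈ S' → r u ≡ 2 * j → r x < 2 * j → Arc G x u
        arc-up u u∈S' r-u≡2j r-x<2j = begin
          G x u                   ≡⟨ rank-arcs x u x∈S' u∈S' ⟩
          blockArc (r x) (r u)    ≡⟨ cong (blockArc (r x)) r-u≡2j ⟩
          blockArc (r x) (2 * j)  ≡⟨ blockArc-< r-x<2j ⟩
          true                    ∎
          where open ≡-Reasoning
        no-arc-up : ¬ r x < 2 * j
        no-arc-up r-x<2j with rank-surjective (2 * j) (subst (2 * j <_) (sym k≡1+2j) (n<1+n (2 * j)))
        ... | u , u∈S' , r-u≡2j
          with () ← trans (sym (B-sink x x∈B u u∈S')) (arc-up u u∈S' r-u≡2j r-x<2j)

      v-arcs : ∀ w → w ∈ S' → G v w ≡ blockArc k (r w)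
      v-arcs w w∈S' with parity k
      ... | j , inj₁ k≡2j = trans v↛w (sym (blockArc-below j k/2≡j r-w<2j))
        where
        r-w<2j : r w < 2 * j
        r-w<2j = subst (r w <_) k≡2j (rank-< w w∈S')
        k/2≡j : ⌊ k /2⌋ ≡ j
        k/2≡j = trans (cong ⌊_/2⌋ k≡2j) (⌊2*j/2⌋≡j j)
        v↛w : G v w ≡ false
        v↛w = Bool.¬-not λ v→w →
          ∣∣≡0⇒∉ B (trans (sym δ≡∣B∣) (δ-even j k≡2j)) (v→w⇒w∈B w w∈S' v→w)
      ... | j , inj₂ k≡1+2j
        with ∣∣>0⇒∃∈ B (subst (0 <_) (trans (sym (δ-odd j k≡1+2j)) δ≡∣B∣) z<s)
      ...   | x , x∈B with w ≟ x
      ...     | yes refl = trans (proj₂ (∈∩⁻ {X = I} x∈B)) (sym (begin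
        blockArc k (r x)                    ≡⟨ cong₂ blockArc k≡1+2j (partner-rank j k≡1+2j x∈B) ⟩
        blockArc (suc (2 * j)) (2 * j)      ≡⟨ blockArc-partner j ⟩
        true                                ∎))
        where open ≡-Reasoning
      ...     | no w≢x = trans v↛w (sym (blockArc-below j k/2≡j r-w<2j))
        where
        k/2≡j : ⌊ k /2⌋ ≡ j
        k/2≡j = trans (cong ⌊_/2⌋ k≡1+2j) (⌊1+2*j/2⌋≡j j)
        v↛w : G v w ≡ false
        v↛w = Bool.¬-not λ v→w → w≢x (B-subsingleton w x (v→w⇒w∈B w w∈S' v→w) x∈B)
        r-w≢2j : r w ≢ 2 * j
        r-w≢2j r-w≡2j = w≢x (rank-injective w x w∈S' (B⊆S' x x∈B)
                                            (trans r-w≡2j (sym (partner-rank j k≡1+2j x∈B))))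
        r-w<2j : r w < 2 * j
        r-w<2j = ≤∧≢⇒< (m<1+n⇒m≤n (subst (r w <_) k≡1+2j (rank-< w w∈S'))) r-w≢2j

      r' : Fin n → ℕ
      r' u = if does (u ≟ v) then k else r u

      r'-v : r' v ≡ k
      r'-v rewrite dec-true (v ≟ v) refl = refl

      r'-S' : ∀ u → u ∈ S' → r' u ≡ r u
      r'-S' u u∈S' rewrite dec-false (u ≟ v) (proj₂ (∈─⁻ u∈S')) = refl

      v-or-S' : ∀ u → u ∈ S → u ≡ v ⊎ u ∈ S'
      v-or-S' u u∈S with u ≟ v
      ... | yes u≡v = inj₁ u≡v
      ... | no u≢v = inj₂ (∈─⁺ u∈S u≢v)

      extended : FRanking G S r'
      extended = record
        { rank-< = rank-<′
        ; rank-injective = rank-injective′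
        ; rank-surjective = rank-surjective′
        ; rank-arcs = rank-arcs′
        }
        where
        rank-<′ : ∀ u → u ∈ S → r' u < ∣ S ∣
        rank-<′ u u∈S with v-or-S' u u∈S
        ... | inj₁ refl = subst (_< ∣ S ∣) (sym r'-v) ∣S'∣<∣S∣
        ... | inj₂ u∈S' =
          subst (_< ∣ S ∣) (sym (r'-S' u u∈S')) (<-trans (rank-< u u∈S') ∣S'∣<∣S∣)

        rank-injective′ : ∀ u w → u ∈ S → w ∈ S → r' u ≡ r' w → u ≡ w
        rank-injective′ u w u∈S w∈S eq with v-or-S' u u∈S | v-or-S' w w∈S
        ... | inj₁ refl | inj₁ refl = refl
        ... | inj₁ refl | inj₂ w∈S' =
          ⊥-elim (<⇒≢ (rank-< w w∈S') (trans (sym (r'-S' w w∈S')) (trans (sym eq) r'-v)))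
        ... | inj₂ u∈S' | inj₁ refl =
          ⊥-elim (<⇒≢ (rank-< u u∈S') (trans (sym (r'-S' u u∈S')) (trans eq r'-v)))
        ... | inj₂ u∈S' | inj₂ w∈S' =
          rank-injective u w u∈S' w∈S' (trans (sym (r'-S' u u∈S')) (trans eq (r'-S' w w∈S')))

        rank-surjective′ : ∀ j → j < ∣ S ∣ → ∃ λ u → u ∈ S × r' u ≡ j
        rank-surjective′ j j<∣S∣ with m<1+n⇒m<n∨m≡n (subst (j <_) ∣S∣≡ j<∣S∣)
        ... | inj₂ refl = v , v∈S , r'-v
        ... | inj₁ j<k with rank-surjective j j<k
        ...   | u , u∈S' , r-u≡j = u , proj₁ (∈─⁻ u∈S') , trans (r'-S' u u∈S') r-u≡j

        rank-arcs′ : ∀ u w → u ∈ S → w ∈ S → G u w ≡ blockArc (r' u) (r' w)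
        rank-arcs′ u w u∈S w∈S with v-or-S' u u∈S | v-or-S' w w∈S
        ... | inj₁ refl | inj₁ refl =
          trans (loopless v) (sym (trans (cong₂ blockArc r'-v r'-v) (blockArc-irrefl k)))
        ... | inj₁ refl | inj₂ w∈S' =
          trans (v-arcs w w∈S') (sym (cong₂ blockArc r'-v (r'-S' w w∈S')))
        ... | inj₂ u∈S' | inj₁ refl =
          trans (S'→v u u∈S') (sym (trans (cong₂ blockArc (r'-S' u u∈S') r'-v)
                                          (blockArc-< (rank-< u u∈S'))))
        ... | inj₂ u∈S' | inj₂ w∈S' =
          trans (rank-arcs u w u∈S' w∈S') (sym (cong₂ blockArc (r'-S' u u∈S') (r'-S' w w∈S')))

  3*M1In≤threeM1Max : (S : Subset n) → 3 * M1In G S ≤ threeM1Max ∣ S ∣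
  3*M1In≤threeM1Max = wfRec Bound bound
    where
    open WF.All (On.wellFounded ∣_∣ <-wellFounded) 0ℓ
    Bound : Subset n → Set
    Bound S = 3 * M1In G S ≤ threeM1Max ∣ S ∣
    bound : ∀ S → WfRec (_<_ on ∣_∣) Bound S → Bound S
    bound S IH with ∃∈? S
    ... | no ∄ = subst (λ m → 3 * m ≤ threeM1Max ∣ S ∣) (sym no-M1) z≤n
      where
      no-M1 : M1In G S ≡ 0
      no-M1 = ∑-zero {X = S} λ u u∈S → ⊥-elim (∄ (u , u∈S))
    ... | yes (u , u∈S) with argmin-∈ (outdegIn G S) u∈S
    ...   | v , v∈S , v-min = begin
      3 * M1In G S              ≡⟨ 3*M1In-S ⟩
      3 * M1In G S' + 3 * gain  ≤⟨ +-mono-≤ (IH ∣S'∣<∣S∣) (*-monoʳ-≤ 3 gain≤) ⟩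
      threeM1Max (suc ∣ S' ∣)   ≡⟨ cong threeM1Max ∣S∣≡ ⟨
      threeM1Max ∣ S ∣          ∎
      where
      open MinOutdegree S v∈S v-min
      open ≤-Reasoning

  extremal⇒FRanking : (S : Subset n) → 3 * M1In G S ≡ threeM1Max ∣ S ∣ → ∃ (FRanking G S)
  extremal⇒FRanking = wfRec Ranks ranking
    where
    open WF.All (On.wellFounded ∣_∣ <-wellFounded) 0ℓ
    Ranks : Subset n → Set
    Ranks S = 3 * M1In G S ≡ threeM1Max ∣ S ∣ → ∃ (FRanking G S)
    ranking : ∀ S → WfRec (_<_ on ∣_∣) Ranks S → Ranks S
    ranking S IH extremal with ∃∈? S
    ... | no ∄ = (λ _ → 0) , empty-FRanking G S (∄∈⇒∣∣≡0 S ∄)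
    ... | yes (u , u∈S) with argmin-∈ (outdegIn G S) u∈S
    ...   | v , v∈S , v-min = r' , extended
      where
      open MinOutdegree S v∈S v-min
      k : ℕ
      k = ∣ S' ∣
      tight : 3 * M1In G S' ≡ threeM1Max k × 3 * gain ≡ 3 * (k * k + k)
      tight = +-tight (3*M1In≤threeM1Max S') (*-monoʳ-≤ 3 gain≤)
                      (trans (sym 3*M1In-S) (trans extremal (cong threeM1Max ∣S∣≡)))
      gain-tight : gain ≡ k * k + k
      gain-tight = *-cancelˡ-≡ gain (k * k + k) 3 (proj₂ tight)
      T-empty : ∣ T ∣ ≡ 0
      T-empty = n≤0⇒n≡0 (+-cancelˡ-≤ gain ∣ T ∣ 0 (begin
        gain + ∣ T ∣       ≤⟨ gain+∣T∣≤ ⟩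
        k * k + k          ≡⟨ gain-tight ⟨
        gain               ≡⟨ +-identityʳ gain ⟨
        gain + 0           ∎))
        where open ≤-Reasoning
      S'-ranked : ∃ (FRanking G S')
      S'-ranked = IH ∣S'∣<∣S∣ (proj₁ tight)
      open Extremal T-empty gain-tight (proj₂ S'-ranked)

  3*M1≤threeM1Max : 3 * M1 G ≤ threeM1Max n
  3*M1≤threeM1Max =
    subst₂ _≤_ (cong (3 *_) (sym (M1≡M1In-full G))) (cong threeM1Max (∣full∣ n)) (3*M1In≤threeM1Max full)

  3*M1≡threeM1Max⇒≅F : 3 * M1 G ≡ threeM1Max n → G ≅ F n
  3*M1≡threeM1Max⇒≅F extremal = FRanking-full⇒≅ G (proj₂ (extremal⇒FRanking full (begin
    3 * M1In G full          ≡⟨ cong (3 *_) (M1≡M1In-full G) ⟨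
    3 * M1 G                 ≡⟨ extremal ⟩
    threeM1Max n             ≡⟨ cong threeM1Max (∣full∣ n) ⟨
    threeM1Max ∣ full {n} ∣  ∎)))
    where open ≡-Reasoning

-- The extremal digraph F

F-loopless : ∀ n → Loopless (F n)
F-loopless n v = blockArc-irrefl (toℕ v)

F-weaklyConnected : ∀ n → WeaklyConnected (F n)
F-weaklyConnected n u w with u ≟ w
... | yes refl = here
... | no u≢w with F n u w in u→w | F n w u in w→u
...   | true | _ = step (inj₁ u→w) here
...   | false | true = step (inj₂ w→u) here
...   | false | false = ⊥-elim (blockArc-total (u≢w ∘ toℕ-injective) u→w w→u)

F-noC3 : ∀ n → ¬ HasC3 (F n)
F-noC3 n (a , b , c , _ , b≢c , a≢c , ab , bc , ca) =
  b≢c (toℕ-injective (trans (same-block⇒blockmate (toℕ a) (toℕ b) a~b (proj₁ (blockArc-sound ab)))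
                            (sym (same-block⇒blockmate (toℕ a) (toℕ c) a~c (a≢c ∘ toℕ-injective)))))
  where
  block-≤ : ∀ {x y} → Arc (F n) x y → ⌊ toℕ x /2⌋ ≤ ⌊ toℕ y /2⌋
  block-≤ x→y = proj₂ (blockArc-sound x→y)
  a~b : ⌊ toℕ a /2⌋ ≡ ⌊ toℕ b /2⌋
  a~b = ≤-antisym (block-≤ ab) (≤-trans (block-≤ bc) (block-≤ ca))
  a~c : ⌊ toℕ a /2⌋ ≡ ⌊ toℕ c /2⌋
  a~c = ≤-antisym (≤-trans (block-≤ ab) (block-≤ bc)) (block-≤ ca)

F-admissible : ∀ n → Admissible (F n)
F-admissible n = F-loopless n , F-weaklyConnected n , F-noC3 n

F-outdeg-shift : ∀ m (i : Fin m) → outdegIn (F (2 + m)) full (suc (suc i)) ≡ outdegIn (F m) full i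
F-outdeg-shift m i = begin
  [ blockArc (2 + a) 0 ] + ([ blockArc (2 + a) 1 ] + shifted)
    ≡⟨ cong₂ (λ x y → [ x ] + ([ y ] + shifted))
             (proj₁ (blockArc-backwards a)) (proj₂ (blockArc-backwards a)) ⟩
  shifted
    ≡⟨ sum-cong-≗ {m} (λ w → cong [_] (blockArc-shift a (toℕ w))) ⟩
  outdegIn (F m) full i
    ∎
  where
  open ≡-Reasoning
  a shifted : ℕ
  a = toℕ i
  shifted = sum {m} (λ w → [ blockArc (2 + a) (2 + toℕ w) ])

F-outdeg-first : ∀ m → outdegIn (F (2 + m)) full zero ≡ suc m
                      × outdegIn (F (2 + m)) full (suc zero) ≡ suc m
F-outdeg-first m = cong suc (∣full∣ m) , cong suc (∣full∣ m)

3*M1In-F : ∀ m → 3 * M1In (F m) full ≡ threeM1Max m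
3*M1In-F 0 = refl
3*M1In-F 1 = refl
3*M1In-F (suc (suc m)) = begin
  3 * (d₀ * d₀ + (d₁ * d₁ + rest))
    ≡⟨ cong₂ (λ x y → 3 * (x * x + (y * y + rest))) (proj₁ first) (proj₂ first) ⟩
  3 * (suc m * suc m + (suc m * suc m + rest))
    ≡⟨ cong (λ x → 3 * (suc m * suc m + (suc m * suc m + x)))
            (sum-cong-≗ λ i → cong (λ x → x * x) (shift i)) ⟩
  3 * (suc m * suc m + (suc m * suc m + M1In (F m) full))
    ≡⟨ expand m (M1In (F m) full) ⟩
  3 * M1In (F m) full + 3 * (m * m + m) + 3 * (suc m * suc m + suc m)
    ≡⟨ cong (λ x → x + 3 * (m * m + m) + 3 * (suc m * suc m + suc m)) (3*M1In-F m) ⟩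
  threeM1Max (suc (suc m))
    ∎
  where
  open ≡-Reasoning
  d : Fin (2 + m) → ℕ
  d = outdegIn (F (2 + m)) full
  d₀ d₁ rest : ℕ
  d₀ = d zero
  d₁ = d (suc zero)
  rest = sum {m} (λ i → d (suc (suc i)) * d (suc (suc i)))
  first : d₀ ≡ suc m × d₁ ≡ suc m
  first = F-outdeg-first m
  shift : ∀ i → d (suc (suc i)) ≡ outdegIn (F m) full i
  shift = F-outdeg-shift m
  expand : ∀ m x → 3 * (suc m * suc m + (suc m * suc m + x))
                 ≡ 3 * x + 3 * (m * m + m) + 3 * (suc m * suc m + suc m)
  expand = solve-∀

3*M1-F : ∀ n → 3 * M1 (F n) ≡ threeM1Max n
3*M1-F n = trans (cong (3 *_) (M1≡M1In-full (F n))) (3*M1In-F n)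

threeBound≡threeM1Max : ∀ q r → 1 ≤ 2 * q + r → r ≤ 1 →
                        threeBound (2 * q + r) q ≡ threeM1Max (2 * q + r)
threeBound≡threeM1Max zero zero ()
threeBound≡threeM1Max (suc p) zero _ _ = begin
  threeBound 2q (suc p)                ≡⟨ cong (2 * suc p *_) (∸-exact (6 * suc p * 2q + 1) (split p)) ⟩
  2 * suc p * (4 * p * p + 8 * p + 3)  ≡⟨ factor p ⟩
  m * suc m * (m + 2)                  ≡⟨ threeM1Max-suc m ⟨
  threeM1Max (suc m)                   ≡⟨ cong threeM1Max (size p) ⟨
  threeM1Max 2q                        ∎
  where
  open ≡-Reasoning
  2q m : ℕ
  2q = 2 * suc p + 0
  m = 2 * p + 1
  split : ∀ p → 3 * (2 * suc p + 0) * (2 * suc p + 0) + 4 * suc p * suc p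
              ≡ 6 * suc p * (2 * suc p + 0) + 1 + (4 * p * p + 8 * p + 3)
  split = solve-∀
  factor : ∀ p → 2 * suc p * (4 * p * p + 8 * p + 3) ≡ (2 * p + 1) * suc (2 * p + 1) * (2 * p + 1 + 2)
  factor = solve-∀
  size : ∀ p → 2 * suc p + 0 ≡ suc (2 * p + 1)
  size = solve-∀
threeBound≡threeM1Max q (suc zero) _ _ = begin
  threeBound (2 * q + 1) q             ≡⟨ cong (2 * q *_) (∸-exact (6 * q * (2 * q + 1) + 1) (split q)) ⟩
  2 * q * (4 * q * q + 6 * q + 2)      ≡⟨ factor q ⟩
  2 * q * suc (2 * q) * (2 * q + 2)    ≡⟨ threeM1Max-suc (2 * q) ⟨
  threeM1Max (suc (2 * q))             ≡⟨ cong threeM1Max (+-comm (2 * q) 1) ⟨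
  threeM1Max (2 * q + 1)               ∎
  where
  open ≡-Reasoning
  split : ∀ q → 3 * (2 * q + 1) * (2 * q + 1) + 4 * q * q
              ≡ 6 * q * (2 * q + 1) + 1 + (4 * q * q + 6 * q + 2)
  split = solve-∀
  factor : ∀ q → 2 * q * (4 * q * q + 6 * q + 2) ≡ 2 * q * suc (2 * q) * (2 * q + 2)
  factor = solve-∀
threeBound≡threeM1Max q (suc (suc r)) _ (s≤s ())

lemma2p1 : (n q r : ℕ) → 1 ≤ n → r ≤ 1 → n ≡ 2 * q + r →
    Admissible (F n) × 3 * M1 (F n) ≡ threeBound n q
    × ((G : Digraph n) → Admissible G → 3 * M1 G ≤ threeBound n q)
    × ((G : Digraph n) → Admissible G → 3 * M1 G ≡ threeBound n q → G ≅ F n)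
lemma2p1 n q r 1≤n r≤1 n≡2q+r =
  F-admissible n , trans (3*M1-F n) max≡bound , bound , uniqueness
  where
  max≡bound : threeM1Max n ≡ threeBound n q
  max≡bound = subst (λ m → threeM1Max m ≡ threeBound m q) (sym n≡2q+r)
                    (sym (threeBound≡threeM1Max q r (subst (1 ≤_) n≡2q+r 1≤n) r≤1))
  bound : (G : Digraph n) → Admissible G → 3 * M1 G ≤ threeBound n q
  bound G (loopless , _ , noC3) = subst (3 * M1 G ≤_) max≡bound (C3Free.3*M1≤threeM1Max loopless noC3)
  uniqueness : (G : Digraph n) → Admissible G → 3 * M1 G ≡ threeBound n q → G ≅ F n
  uniqueness G (loopless , _ , noC3) extremal =
    C3Free.3*M1≡threeM1Max⇒≅F loopless noC3 (trans extremal (sym max≡bound))
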